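{- Let $n\geq 1$. If $\Lambda\in\mathrm{NC}(n)$ has $k$ blocks, then $\Lambda^+\in\mathrm{NC}(n)$ and $\Lambda^+$ has $n+1-k$ blocks. (That is, $\Lambda\mapsto\Lambda^+$ is rank inverting on $\mathrm{NC}(n)$.)
   Context: A set partition of a finite set $X\subset\mathbb{Z}$ is a set of nonempty pairwise disjoint blocks with union $X$. For $i<j$, $(i,j)$ is an arc of $\Lambda$ if $i,j$ lie in the same block and $j$ is the least element of that block greater than $i$; $\mathrm{Arc}(\Lambda)$ is the set of arcs (a partition is determined by its arcs). $\Lambda$ is noncrossing if there are no arcs $(i,k),(j,l)$ with $i<j<k<l$. $\mathrm{NC}(n)$ is the set of noncrossing partitions of $[n]=\{1,\dots,n\}$. For a partition $\Lambda$ of $X$, $\Lambda^+$ is the partition of $X$ with arc set $(\mathrm{Arc}(\Lambda)\setminus\mathcal{S})\cup\mathcal{T}$, where $\mathcal{S}=\{(i,i+1):i\in\mathbb{Z}\}$ and $\mathcal{T}$ is the set of pairs $(i,i+1)\in X\times X$ such that $i$ is the maximal element of its block and $i+1$ is the minimal element of its block. -}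

module Defs where

open import Data.Nat using (ℕ; suc; _≤_; _<_)
open import Data.List using (List; []; concat)
open import Data.List.Membership.Propositional using (_∈_)
open import Data.List.Relation.Unary.All using (All)
open import Data.List.Relation.Unary.Unique.Propositional using (Unique)
open import Data.List.Relation.Unary.Any using (Any)
open import Data.Product using (Σ; _×_)
open import Data.Sum using (_⊎_)
open import Relation.Nullary using (¬_)
open import Relation.Binary.PropositionalEquality using (_≡_; _≢_)
open import Function.Bundles using (_⇔_)

-- A (candidate) set partition is given as a list of blocks; a block is a
-- list of integers (we use ℕ, since the ground set is [n] = {1,…,n}).
Blocks : Set
Blocks = List (List ℕ)

-- Λ is a set partition of [n] = {1,…,n}: blocks are nonempty, no element
-- occurs twice overall (so blocks are pairwise disjoint sets, and the list
-- of blocks has no repetitions), and the union of the blocks is [n].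
record IsPartition (n : ℕ) (Λ : Blocks) : Set where
  field
    nonempty : All (λ b → b ≢ []) Λ
    disjoint : Unique (concat Λ)
    cover    : ∀ x → (1 ≤ x × x ≤ n) ⇔ Any (x ∈_) Λ

#blocks : Blocks → ℕ
#blocks = Data.List.length

SameBlock : Blocks → ℕ → ℕ → Set
SameBlock Λ x y = Any (λ b → x ∈ b × y ∈ b) Λ

IsArc : Blocks → ℕ → ℕ → Set
IsArc Λ i j = i < j × SameBlock Λ i j × (∀ m → SameBlock Λ i m → i < m → j ≤ m)

NonCrossing : Blocks → Set
NonCrossing Λ = ∀ i j k l → IsArc Λ i k → IsArc Λ j l → ¬ (i < j × j < k × k < l)

IsBlockMax : Blocks → ℕ → Set
IsBlockMax Λ i = SameBlock Λ i i × (∀ m → SameBlock Λ i m → m ≤ i)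

IsBlockMin : Blocks → ℕ → Set
IsBlockMin Λ i = SameBlock Λ i i × (∀ m → SameBlock Λ i m → i ≤ m)

-- Arc set of Λ⁺ : (Arc(Λ) ∖ S) ∪ T, with S = {(i,i+1)} and
-- T = {(i,i+1) ∈ X×X : i max of its block, i+1 min of its block}.
PlusArc : Blocks → ℕ → ℕ → Set
PlusArc Λ i j =
  (IsArc Λ i j × j ≢ suc i) ⊎ (j ≡ suc i × IsBlockMax Λ i × IsBlockMin Λ j)

-- Λ' is Λ⁺ : its arc set is exactly (Arc(Λ) ∖ S) ∪ T
-- (a partition is determined by its arcs, so this pins Λ' down as Λ⁺).
IsPlusOf : Blocks → Blocks → Set
IsPlusOf Λ' Λ = ∀ i j → IsArc Λ' i j ⇔ PlusArc Λ i j

module Submission where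

-- Call a relation Arc on [n] an arc system if its pairs go upwards
-- and every point has at most one arc into it and at most one arc out of
-- it.  Every arc system is the arc set of a partition of [n] (its blocks
-- are the maximal arc chains), and that partition has one block per point
-- without an incoming arc.  The arc set (Arc(Λ) ∖ S) ∪ T of Λ⁺ is an arc
-- system, which yields Λ⁺ together with a formula for its number of blocks.
-- Λ⁺ is noncrossing because its arcs are arcs of Λ or short arcs (i, i+1),
-- and nothing crosses a short arc.  For the count, noncrossingness of Λ
-- gives, for 1 ≤ j < n,
--     j + 1 has an incoming Λ⁺-arc  ⇔  j is the maximum of its Λ-block,
-- while 1 never has an incoming arc and n is always a block maximum.  As
-- every block of Λ has exactly one maximum, the points without an incoming
-- Λ⁺-arc and the k block maxima of Λ together number n + 1.

open import Defs
open import Data.Empty using (⊥; ⊥-elim)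
open import Data.List using (List; []; _∷_; _++_; concat; map; filter; length; applyDownFrom)
open import Data.List.Extrema.Nat using (max; argmax-sel; ⊥≤max; xs≤max)
open import Data.List.Membership.Propositional using (_∈_; find; lose)
open import Data.List.Membership.Propositional.Properties
  using (∈-applyDownFrom⁺; ∈-applyDownFrom⁻; ∈-filter⁺; ∈-filter⁻; ∈-map⁺; ∈-concat⁺; ∈-concat⁻; concat-∈↔)
open import Data.List.Membership.Propositional.Properties.WithK using (unique⇒irrelevant; unique∧set⇒bag)
open import Data.List.Properties using (length-map)
open import Data.List.Relation.Binary.BagAndSetEquality using (∼bag⇒↭)
open import Data.List.Relation.Binary.Permutation.Propositional using (_↭_)
open import Data.List.Relation.Binary.Permutation.Propositional.Properties using (filter-↭; ↭-length)
open import Data.List.Relation.Unary.All as All using (All; []; _∷_)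
import Data.List.Relation.Unary.All.Properties as All
open import Data.List.Relation.Unary.AllPairs as AllPairs using ([]; _∷_)
import Data.List.Relation.Unary.AllPairs.Properties as AllPairs
open import Data.List.Relation.Unary.Any as Any using (Any; here; there)
import Data.List.Relation.Unary.Any.Properties as Any
open import Data.List.Relation.Unary.Unique.Propositional using (Unique)
open import Data.List.Relation.Unary.Unique.Propositional.Properties
  using (applyDownFrom⁺₁; filter⁺; concat⁺)
open import Data.Nat using (ℕ; zero; suc; _≤_; _<_; _+_; _∸_; z≤n; s≤s; _≟_; _≤?_; _<?_)
open import Data.Nat.Properties
open import Data.List.Membership.DecPropositional _≟_ using (_∈?_)
open import Algebra.Properties.CommutativeSemigroup +-commutativeSemigroup using (interchange)
open import Data.Product using (Σ; _×_; _,_; proj₁; proj₂; ∃; swap)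
open import Data.Sum using (_⊎_; inj₁; inj₂; [_,_]′)
open import Function.Bundles using (_⇔_; mk⇔; Equivalence; Inverse)
open import Relation.Binary.Definitions using (tri<; tri≈; tri>)
open import Relation.Binary.PropositionalEquality
open import Relation.Nullary using (¬_; Dec; yes; no)
open import Relation.Nullary.Decidable using (map′; ¬?; _×-dec_; _⊎-dec_; _→-dec_)
open import Relation.Unary using (Decidable)

open Equivalence using (to; from)
open ≡-Reasoning

private
  variable
    A : Set
    a i i′ j j′ m r r′ x y z : ℕ
    xs ys : List A

In : ℕ → ℕ → Set
In n x = 1 ≤ x × x ≤ n

range : ℕ → List ℕ
range = applyDownFrom suc

∈-range⁺ : ∀ {n} → In n x → x ∈ range n
∈-range⁺ {suc x} (_ , x<n) = ∈-applyDownFrom⁺ suc x<n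

∈-range⁻ : ∀ {n} → x ∈ range n → In n x
∈-range⁻ x∈ with _ , i<n , refl ← ∈-applyDownFrom⁻ suc x∈ = s≤s z≤n , i<n

range-unique : ∀ n → Unique (range n)
range-unique n = applyDownFrom⁺₁ suc n (λ j<i _ eq → <⇒≢ j<i (sym (suc-injective eq)))

unique-set⇒↭ : Unique xs → Unique ys → (∀ {x} → x ∈ xs ⇔ x ∈ ys) → xs ↭ ys
unique-set⇒↭ uxs uys same = ∼bag⇒↭ (unique∧set⇒bag uxs uys same)

unique-++ˡ : ∀ (xs : List A) {ys} → Unique (xs ++ ys) → Unique xs
unique-++ˡ [] _ = []
unique-++ˡ (x ∷ xs) (x∉ ∷ u) = All.++⁻ˡ xs x∉ ∷ unique-++ˡ xs u

unique-++ʳ : ∀ (xs : List A) {ys} → Unique (xs ++ ys) → Unique ys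
unique-++ʳ [] u = u
unique-++ʳ (x ∷ xs) (_ ∷ u) = unique-++ʳ xs u

unique-concat⁻ : ∀ (xss : List (List A)) → Unique (concat xss) → xs ∈ xss → Unique xs
unique-concat⁻ (ys ∷ yss) u (here refl) = unique-++ˡ ys u
unique-concat⁻ (ys ∷ yss) u (there xs∈) = unique-concat⁻ yss (unique-++ʳ ys u) xs∈

-- If concat xss is duplicate-free, an element lies in at most one list of xss:
-- its position in concat xss determines the list it comes from.
member-unique : {xss : List (List A)} {v : A} → Unique (concat xss) →
  xs ∈ xss → ys ∈ xss → v ∈ xs → v ∈ ys → xs ≡ ys
member-unique u xs∈ ys∈ v∈xs v∈ys = cong proj₁ (begin
  (_ , v∈xs , xs∈)            ≡⟨ strictlyInverseʳ _ ⟨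
  from′ (to′ (_ , v∈xs , xs∈)) ≡⟨ cong from′ (unique⇒irrelevant u _ _) ⟩
  from′ (to′ (_ , v∈ys , ys∈)) ≡⟨ strictlyInverseʳ _ ⟩
  (_ , v∈ys , ys∈)            ∎)
  where open Inverse concat-∈↔ renaming (to to to′; from to from′)

ind : {B : Set} → Dec B → ℕ
ind (yes _) = 1
ind (no _) = 0

ind-yes : {B : Set} (d : Dec B) → B → ind d ≡ 1
ind-yes (yes _) _ = refl
ind-yes (no ¬b) b = ⊥-elim (¬b b)

ind-complement : {B C : Set} (d : Dec B) (e : Dec C) → B ⇔ (¬ C) → ind d + ind e ≡ 1
ind-complement (yes b) (yes c) b⇔¬c = ⊥-elim (to b⇔¬c b c)
ind-complement (yes _) (no _) _ = refl
ind-complement (no _) (yes _) _ = refl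
ind-complement (no ¬b) (no ¬c) b⇔¬c = ⊥-elim (¬b (from b⇔¬c ¬c))

count : {P : A → Set} → Decidable P → List A → ℕ
count P? [] = 0
count P? (x ∷ xs) = ind (P? x) + count P? xs

count-filter : {P : A → Set} (P? : Decidable P) (xs : List A) → count P? xs ≡ length (filter P? xs)
count-filter P? [] = refl
count-filter P? (x ∷ xs) with P? x
... | yes _ = cong suc (count-filter P? xs)
... | no _ = count-filter P? xs

count-++ : {P : A → Set} (P? : Decidable P) (xs ys : List A) → count P? (xs ++ ys) ≡ count P? xs + count P? ys
count-++ P? [] ys = refl
count-++ P? (x ∷ xs) ys = trans (cong (ind (P? x) +_) (count-++ P? xs ys)) (sym (+-assoc (ind (P? x)) _ _))

count-↭ : {P : A → Set} (P? : Decidable P) → xs ↭ ys → count P? xs ≡ count P? ys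
count-↭ {xs = xs} {ys = ys} P? xs↭ys = begin
  count P? xs            ≡⟨ count-filter P? xs ⟩
  length (filter P? xs)  ≡⟨ ↭-length (filter-↭ P? xs↭ys) ⟩
  length (filter P? ys)  ≡⟨ count-filter P? ys ⟨
  count P? ys            ∎

count-concat : {P : A → Set} (P? : Decidable P) (xss : List (List A)) →
  All (λ xs → count P? xs ≡ 1) xss → length xss ≡ count P? (concat xss)
count-concat P? [] [] = refl
count-concat P? (xs ∷ xss) (one ∷ ones) = begin
  suc (length xss)                     ≡⟨ cong₂ _+_ (sym one) (count-concat P? xss ones) ⟩
  count P? xs + count P? (concat xss)  ≡⟨ count-++ P? xs (concat xss) ⟨
  count P? (xs ++ concat xss)          ∎

count-complementary : {P Q : ℕ → Set} (P? : Decidable P) (Q? : Decidable Q) (N : ℕ) → 1 ≤ N →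
  P 1 → Q N → (∀ j → 1 ≤ j → j < N → P (suc j) ⇔ (¬ Q j)) →
  count P? (range N) + count Q? (range N) ≡ suc N
count-complementary {P} {Q} P? Q? (suc N) _ p₁ q-last shifted = begin
  count P? (range (suc N)) + (ind (Q? (suc N)) + count Q? (range N))
    ≡⟨ cong (λ t → count P? (range (suc N)) + (t + count Q? (range N))) (ind-yes (Q? (suc N)) q-last) ⟩
  count P? (range (suc N)) + suc (count Q? (range N))
    ≡⟨ +-suc _ _ ⟩
  suc (count P? (range (suc N)) + count Q? (range N))
    ≡⟨ cong suc (prefix N ≤-refl) ⟩
  suc (suc N) ∎
  where
  prefix : ∀ j → j ≤ N → count P? (range (suc j)) + count Q? (range j) ≡ suc j
  prefix zero _ = cong (λ t → t + 0 + 0) (ind-yes (P? 1) p₁)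
  prefix (suc j) 1+j≤N = begin
    (ind (P? (suc (suc j))) + count P? (range (suc j))) + (ind (Q? (suc j)) + count Q? (range j))
      ≡⟨ interchange (ind (P? (suc (suc j)))) _ _ _ ⟩
    (ind (P? (suc (suc j))) + ind (Q? (suc j))) + (count P? (range (suc j)) + count Q? (range j))
      ≡⟨ cong₂ _+_ (ind-complement (P? (suc (suc j))) (Q? (suc j)) (shifted (suc j) (s≤s z≤n) (s≤s 1+j≤N)))
                   (prefix j (<⇒≤ 1+j≤N)) ⟩
    suc (suc j) ∎

least-witness : {P : ℕ → Set} → Decidable P → P m → ∃ λ x → P x × (∀ {y} → y < x → ¬ P y)
least-witness {m = m} {P} P? pm = search (suc m) ≤-refl pm
  where
  search : ∀ b {m} → m < b → P m → ∃ λ x → P x × (∀ {y} → y < x → ¬ P y)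
  search (suc b) {m} (s≤s m≤b) pm with anyUpTo? P? m
  ... | no none = m , pm , λ y<m py → none (_ , y<m , py)
  ... | yes (_ , y<m , py) = search b (<-≤-trans y<m m≤b) py

greatest-below : {P : ℕ → Set} → Decidable P → ∀ {b} → m < b → P m →
  ∃ λ x → P x × x < b × (∀ {y} → x < y → y < b → ¬ P y)
greatest-below {m} P? {suc b} (s≤s m≤b) pm with P? b
... | yes pb = b , pb , ≤-refl , λ b<y y<1+b _ → <⇒≱ b<y (≤-pred y<1+b)
... | no ¬pb =
  let x , px , x<b , none-above = greatest-below P? (≤∧≢⇒< m≤b λ { refl → ¬pb pm }) pm
  in x , px , m≤n⇒m≤1+n x<b ,
     λ x<y y<1+b → [ none-above x<y , (λ { refl → ¬pb }) ]′ (m≤n⇒m<n∨m≡n (≤-pred y<1+b))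

-- Following
-- arcs backwards from any point reaches a unique point without incoming arc,
-- its root; the blocks {x : root x = r} form a partition Λ' of [n] whose arcs
-- are exactly the given ones, with one block per point without incoming arc.
module ArcSystem
  (n : ℕ) (Arc : ℕ → ℕ → Set)
  (incoming? : ∀ j → Dec (∃ λ i → Arc i j))
  (arc-< : ∀ {i j} → Arc i j → i < j)
  (arc-in : ∀ {i j} → Arc i j → In n i × In n j)
  (source-unique : ∀ {i i′ j} → Arc i j → Arc i′ j → i ≡ i′)
  (target-unique : ∀ {i j j′} → Arc i j → Arc i j′ → j ≡ j′)
  where

  Initial : ℕ → Set
  Initial j = ¬ ∃ λ i → Arc i j

  initial? : Decidable Initial
  initial? j = ¬? (incoming? j)

  data Chain (a : ℕ) : ℕ → Set where
    done : Chain a a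
    _▸_ : Chain a i → Arc i x → Chain a x

  chain-≤ : Chain a x → a ≤ x
  chain-≤ done = ≤-refl
  chain-≤ (c ▸ arc) = ≤-trans (chain-≤ c) (<⇒≤ (arc-< arc))

  chain-in : ∀ {a x} → Chain a x → In n x → In n a
  chain-in done ix = ix
  chain-in (c ▸ arc) _ = chain-in c (proj₁ (arc-in arc))

  chain-initial : Chain a x → Initial x → a ≡ x
  chain-initial done _ = refl
  chain-initial (_ ▸ arc) init = ⊥-elim (init (_ , arc))

  first-arc : Chain a x → a ≡ x ⊎ ∃ λ y → Arc a y × Chain y x
  first-arc done = inj₁ refl
  first-arc (c ▸ arc) with first-arc c
  ... | inj₁ refl = inj₂ (_ , arc , done)
  ... | inj₂ (y , arc₁ , c′) = inj₂ (y , arc₁ , c′ ▸ arc)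

  chains-to : Chain a x → Chain y x → Chain a y ⊎ Chain y a
  chains-to done c = inj₂ c
  chains-to (c ▸ arc) done = inj₁ (c ▸ arc)
  chains-to (c ▸ arc) (c′ ▸ arc′) with refl ← source-unique arc arc′ = chains-to c c′

  chains-from : Chain a x → Chain a y → Chain x y ⊎ Chain y x
  chains-from cx done = inj₂ cx
  chains-from cx (cy ▸ arc) with chains-from cx cy
  ... | inj₁ c = inj₁ (c ▸ arc)
  ... | inj₂ c with first-arc c
  ...   | inj₁ refl = inj₁ (done ▸ arc)
  ...   | inj₂ (_ , arc′ , c′) with refl ← target-unique arc arc′ = inj₂ c′

  root-from : ℕ → ℕ → ℕ
  root-from zero x = x
  root-from (suc f) x with incoming? x
  ... | yes (i , _) = root-from f i
  ... | no _ = x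

  root-from-spec : ∀ f x → x ≤ f → Chain (root-from f x) x × Initial (root-from f x)
  root-from-spec zero zero _ = done , λ (_ , arc) → n≮0 (arc-< arc)
  root-from-spec (suc f) x x≤f with incoming? x
  ... | yes (i , arc) =
    let c , init = root-from-spec f i (≤-pred (≤-trans (arc-< arc) x≤f)) in c ▸ arc , init
  ... | no none = done , none

  root : ℕ → ℕ
  root x = root-from x x

  root-chain : ∀ x → Chain (root x) x
  root-chain x = proj₁ (root-from-spec x x ≤-refl)

  root-initial : ∀ x → Initial (root x)
  root-initial x = proj₂ (root-from-spec x x ≤-refl)

  root-unique : Chain a x → Initial a → root x ≡ a
  root-unique {x = x} c init with chains-to c (root-chain x)
  ... | inj₁ c′ = sym (chain-initial c′ (root-initial x))
  ... | inj₂ c′ = chain-initial c′ init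

  root-arc : Arc i x → root x ≡ root i
  root-arc {i} arc = root-unique (root-chain i ▸ arc) (root-initial i)

  root-of-initial : Initial x → root x ≡ x
  root-of-initial init = root-unique done init

  arc-gap : Arc i j → root m ≡ root i → i < m → m < j → ⊥
  arc-gap {i} {j} {m} arc same i<m m<j
    with chains-from (root-chain i) (subst (λ r → Chain r m) same (root-chain m))
  ... | inj₂ c = <⇒≱ i<m (chain-≤ c)
  ... | inj₁ c with first-arc c
  ...   | inj₁ refl = <-irrefl refl i<m
  ...   | inj₂ (_ , arc′ , c′) with refl ← target-unique arc arc′ = <⇒≱ m<j (chain-≤ c′)

  Connected : ℕ → ℕ → Set
  Connected x y = In n x × In n y × root x ≡ root y

  arc⇒connected-arc : Arc i j → i < j × Connected i j × (∀ m → Connected i m → i < m → j ≤ m)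
  arc⇒connected-arc arc =
    arc-< arc , (proj₁ (arc-in arc) , proj₂ (arc-in arc) , sym (root-arc arc)) ,
    λ m (_ , _ , same) i<m → ≮⇒≥ (arc-gap arc (sym same) i<m)

  connected-arc⇒arc : i < j → Connected i j → (∀ m → Connected i m → i < m → j ≤ m) → Arc i j
  connected-arc⇒arc {i} {j} i<j (ii , _ , same) nearest with incoming? j
  ... | no init =
    ⊥-elim (<⇒≱ i<j (subst (_≤ i) (trans same (root-of-initial init)) (chain-≤ (root-chain i))))
  ... | yes (i′ , arc) with <-cmp i i′
  ...   | tri≈ _ refl _ = arc
  ...   | tri< i<i′ _ _ =
    ⊥-elim (<⇒≱ (arc-< arc) (nearest i′ (ii , proj₁ (arc-in arc) , trans same (root-arc arc)) i<i′))
  ...   | tri> _ _ i′<i = ⊥-elim (arc-gap arc (trans same (root-arc arc)) i′<i i<j)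

  roots : List ℕ
  roots = filter initial? (range n)

  block : ℕ → List ℕ
  block r = filter (λ x → root x ≟ r) (range n)

  Λ′ : Blocks
  Λ′ = map block roots

  ∈-block⁻ : x ∈ block r → In n x × root x ≡ r
  ∈-block⁻ x∈ = let x∈range , same = ∈-filter⁻ (λ x → root x ≟ _) x∈ in ∈-range⁻ x∈range , same

  ∈-block⁺ : In n x → x ∈ block (root x)
  ∈-block⁺ ix = ∈-filter⁺ (λ x → root x ≟ _) (∈-range⁺ ix) refl

  ∈-roots⁺ : In n x → root x ∈ roots
  ∈-roots⁺ {x} ix = ∈-filter⁺ initial? (∈-range⁺ (chain-in (root-chain x) ix)) (root-initial x)

  root∈block : r ∈ roots → r ∈ block r
  root∈block {r} r∈ = let r∈range , init = ∈-filter⁻ initial? {xs = range n} r∈ in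
    ∈-filter⁺ (λ x → root x ≟ r) r∈range (root-of-initial init)

  blocks-disjoint : r ≢ r′ → ∀ {v} → ¬ (v ∈ block r × v ∈ block r′)
  blocks-disjoint r≢r′ (v∈r , v∈r′) = r≢r′ (trans (sym (proj₂ (∈-block⁻ v∈r))) (proj₂ (∈-block⁻ v∈r′)))

  any-block⁻ : {S : List ℕ → Set} → Any S Λ′ → ∃ λ r → S (block r)
  any-block⁻ s = let r , _ , sr = find (Any.map⁻ s) in r , sr

  same-block⇔connected : SameBlock Λ′ x y ⇔ Connected x y
  same-block⇔connected {x} {y} = mk⇔ connected same-block
    where
    connected : SameBlock Λ′ x y → Connected x y
    connected s = let _ , x∈ , y∈ = any-block⁻ s
                      ix , rx = ∈-block⁻ x∈
                      iy , ry = ∈-block⁻ y∈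
                  in ix , iy , trans rx (sym ry)
    same-block : Connected x y → SameBlock Λ′ x y
    same-block (ix , iy , same) =
      lose (∈-map⁺ block (∈-roots⁺ ix)) (∈-block⁺ ix , subst (λ r → y ∈ block r) (sym same) (∈-block⁺ iy))

  partition : IsPartition n Λ′
  partition = record
    { nonempty = All.map⁺ (All.tabulate λ r∈ empty → Any.¬Any[] (subst (_ ∈_) empty (root∈block r∈)))
    ; disjoint = concat⁺ (All.map⁺ (All.tabulate λ _ → filter⁺ _ (range-unique n)))
                         (AllPairs.map⁺ (AllPairs.map blocks-disjoint (filter⁺ initial? (range-unique n))))
    ; cover = λ x → mk⇔ (λ ix → lose (∈-map⁺ block (∈-roots⁺ ix)) (∈-block⁺ ix))
                        (λ x∈ → proj₁ (∈-block⁻ (proj₂ (any-block⁻ x∈))))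
    }

  arcs : ∀ i j → IsArc Λ′ i j ⇔ Arc i j
  arcs i j = mk⇔
    (λ (i<j , s , nearest) →
       connected-arc⇒arc i<j (to same-block⇔connected s) λ m c → nearest m (from same-block⇔connected c))
    (λ arc → let i<j , c , nearest = arc⇒connected-arc arc in
       i<j , from same-block⇔connected c , λ m s → nearest m (to same-block⇔connected s))

  #blocks-Λ′ : #blocks Λ′ ≡ count initial? (range n)
  #blocks-Λ′ = trans (length-map block roots) (sym (count-filter initial? (range n)))

same-block-sym : ∀ {Λ} → SameBlock Λ x y → SameBlock Λ y x
same-block-sym = Any.map swap

arc-target-unique : ∀ {Λ} → IsArc Λ i j → IsArc Λ i j′ → j ≡ j′
arc-target-unique (i<j , s , nearest) (i<j′ , s′ , nearest′) =
  ≤-antisym (nearest _ s′ i<j′) (nearest′ _ s i<j)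

arc-not-max : ∀ {Λ} → IsArc Λ i j → ¬ IsBlockMax Λ i
arc-not-max (i<j , s , _) (_ , below) = <⇒≱ i<j (below _ s)

arc-not-min : ∀ {Λ} → IsArc Λ i j → ¬ IsBlockMin Λ j
arc-not-min (i<j , s , _) (_ , above) = <⇒≱ i<j (above _ (same-block-sym s))

-- Λ⁺ is noncrossing when Λ is: its arcs are arcs of Λ or short arcs
-- (i, i + 1), and a short arc crosses nothing.
plus-noncrossing : ∀ {Λ Λ⁺} → NonCrossing Λ → IsPlusOf Λ⁺ Λ → NonCrossing Λ⁺
plus-noncrossing {Λ} nc plus i j k l a₁ a₂ = crossing (to (plus i k) a₁) (to (plus j l) a₂)
  where
  crossing : PlusArc Λ i k → PlusArc Λ j l → ¬ (i < j × j < k × k < l)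
  crossing (inj₂ (refl , _)) _ (i<j , j<k , _) = <⇒≱ i<j (≤-pred j<k)
  crossing (inj₁ _) (inj₂ (refl , _)) (_ , j<k , k<l) = <⇒≱ j<k (≤-pred k<l)
  crossing (inj₁ (arc₁ , _)) (inj₁ (arc₂ , _)) order = nc i j k l arc₁ arc₂ order

module PartitionFacts {n : ℕ} {Λ : Blocks} (isPartition : IsPartition n Λ) where
  open IsPartition isPartition

  same-block-in : SameBlock Λ x y → In n x × In n y
  same-block-in s = let _ , b∈ , x∈ , y∈ = find s in
    from (cover _) (lose b∈ x∈) , from (cover _) (lose b∈ y∈)

  same-block-refl : In n x → SameBlock Λ x x
  same-block-refl ix = Any.map (λ x∈ → x∈ , x∈) (to (cover _) ix)

  block-closed : ∀ {b} → b ∈ Λ → x ∈ b → SameBlock Λ x m → m ∈ b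
  block-closed b∈ x∈ s = let _ , c∈ , x∈c , m∈c = find s in
    subst (_ ∈_) (member-unique disjoint c∈ b∈ x∈c x∈) m∈c

  same-block-trans : SameBlock Λ x y → SameBlock Λ y z → SameBlock Λ x z
  same-block-trans s t = let _ , b∈ , x∈ , y∈ = find s in lose b∈ (x∈ , block-closed b∈ y∈ t)

  same-block? : ∀ x y → Dec (SameBlock Λ x y)
  same-block? x y = Any.any? (λ b → (x ∈? b) ×-dec (y ∈? b)) Λ

  -- Statements about all block-mates are decidable, since they lie in [n].
  all-block-mates? : {S : ℕ → Set} → Decidable S → ∀ i → Dec (∀ m → SameBlock Λ i m → S m)
  all-block-mates? S? i =
    map′ (λ all m s → all {m} (s≤s (proj₂ (proj₂ (same-block-in s)))) s) (λ all {m} _ → all m)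
         (allUpTo? (λ m → same-block? i m →-dec S? m) (suc n))

  is-arc? : ∀ i j → Dec (IsArc Λ i j)
  is-arc? i j = (i <? j) ×-dec same-block? i j ×-dec all-block-mates? (λ m → (i <? m) →-dec (j ≤? m)) i

  is-block-max? : Decidable (IsBlockMax Λ)
  is-block-max? i = same-block? i i ×-dec all-block-mates? (_≤? i) i

  is-block-min? : Decidable (IsBlockMin Λ)
  is-block-min? j = same-block? j j ×-dec all-block-mates? (j ≤?_) j

  arc-source-unique : IsArc Λ i j → IsArc Λ i′ j → i ≡ i′
  arc-source-unique {i} {j} {i′} (i<j , s , nearest) (i′<j , s′ , nearest′) with <-cmp i i′
  ... | tri≈ _ i≡i′ _ = i≡i′
  ... | tri< i<i′ _ _ = ⊥-elim (<⇒≱ i′<j (nearest i′ (same-block-trans s (same-block-sym s′)) i<i′))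
  ... | tri> _ _ i′<i = ⊥-elim (<⇒≱ i<j (nearest′ i (same-block-trans s′ (same-block-sym s)) i′<i))

  arc-out : In n i → ¬ IsBlockMax Λ i → ∃ λ j → IsArc Λ i j
  arc-out {i} ii not-max with anyUpTo? (λ m → same-block? i m ×-dec (i <? m)) (suc n)
  ... | no none = ⊥-elim (not-max (same-block-refl ii ,
        λ m s → ≮⇒≥ λ i<m → none (m , s≤s (proj₂ (proj₂ (same-block-in s))) , s , i<m)))
  ... | yes (_ , _ , above) =
    let j , (s , i<j) , first = least-witness (λ m → same-block? i m ×-dec (i <? m)) above in
    j , i<j , s , λ m s′ i<m → ≮⇒≥ λ m<j → first m<j (s′ , i<m)

  arc-into : In n j → ¬ IsBlockMin Λ j → ∃ λ i → IsArc Λ i j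
  arc-into {j} ij not-min with anyUpTo? (λ m → same-block? m j) j
  ... | no none = ⊥-elim (not-min (same-block-refl ij ,
        λ m s → ≮⇒≥ λ m<j → none (m , m<j , same-block-sym s)))
  ... | yes (_ , m<j , s) =
    let i , s′ , i<j , last = greatest-below (λ m → same-block? m j) m<j s in
    i , i<j , s′ , λ m s″ i<m → ≮⇒≥ λ m<j → last i<m m<j (same-block-trans (same-block-sym s″) s′)

  one-max-per-block : ∀ {b} → b ∈ Λ → count is-block-max? b ≡ 1
  one-max-per-block {[]} b∈ = ⊥-elim (All.lookup nonempty b∈ refl)
  one-max-per-block {x ∷ xs} b∈ = begin
    count is-block-max? (x ∷ xs)           ≡⟨ count-filter is-block-max? (x ∷ xs) ⟩
    length (filter is-block-max? (x ∷ xs)) ≡⟨ ↭-length (unique-set⇒↭ unique-maxima ([] ∷ []) maxima) ⟩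
    1                                      ∎
    where
    top : ℕ
    top = max x xs
    top∈ : top ∈ x ∷ xs
    top∈ = [ here , there ]′ (argmax-sel (λ v → v) x xs)
    top-largest : All (_≤ top) (x ∷ xs)
    top-largest = ⊥≤max x xs ∷ xs≤max x xs
    unique-maxima : Unique (filter is-block-max? (x ∷ xs))
    unique-maxima = filter⁺ is-block-max? (unique-concat⁻ Λ disjoint b∈)
    top-max : IsBlockMax Λ top
    top-max = lose b∈ (top∈ , top∈) , λ m s → All.lookup top-largest (block-closed b∈ top∈ s)
    maxima : ∀ {z} → z ∈ filter is-block-max? (x ∷ xs) ⇔ z ∈ top ∷ []
    maxima = mk⇔
      (λ z∈ → let z∈b , (_ , below) = ∈-filter⁻ is-block-max? z∈ in
        here (≤-antisym (All.lookup top-largest z∈b) (below top (lose b∈ (z∈b , top∈)))))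
      (λ { (here refl) → ∈-filter⁺ is-block-max? top∈ top-max })

  #blocks≡#maxima : #blocks Λ ≡ count is-block-max? (range n)
  #blocks≡#maxima = begin
    #blocks Λ                       ≡⟨ count-concat is-block-max? Λ (All.tabulate one-max-per-block) ⟩
    count is-block-max? (concat Λ)  ≡⟨ count-↭ is-block-max? (unique-set⇒↭ disjoint (range-unique n) members) ⟩
    count is-block-max? (range n)   ∎
    where
    members : ∀ {x} → x ∈ concat Λ ⇔ x ∈ range n
    members = mk⇔ (λ x∈ → ∈-range⁺ (from (cover _) (∈-concat⁻ Λ x∈)))
                  (λ x∈ → ∈-concat⁺ (to (cover _) (∈-range⁻ x∈)))

  -- Plus-arcs are decidable, go upwards within [n], and form an arc system:
  -- an arc of Λ neither ends at a block minimum nor starts at a block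
  -- maximum, so it never shares a target or a source with a new arc (i, i + 1).
  plus-arc? : ∀ i j → Dec (PlusArc Λ i j)
  plus-arc? i j = (is-arc? i j ×-dec ¬? (j ≟ suc i)) ⊎-dec (j ≟ suc i ×-dec is-block-max? i ×-dec is-block-min? j)

  plus-arc-< : PlusArc Λ i j → i < j
  plus-arc-< (inj₁ ((i<j , _) , _)) = i<j
  plus-arc-< (inj₂ (refl , _)) = ≤-refl

  plus-arc-in : PlusArc Λ i j → In n i × In n j
  plus-arc-in (inj₁ ((_ , s , _) , _)) = same-block-in s
  plus-arc-in (inj₂ (_ , (s , _) , (s′ , _))) = proj₁ (same-block-in s) , proj₁ (same-block-in s′)

  plus-arc-source-unique : PlusArc Λ i j → PlusArc Λ i′ j → i ≡ i′
  plus-arc-source-unique (inj₁ (arc , _)) (inj₁ (arc′ , _)) = arc-source-unique arc arc′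
  plus-arc-source-unique (inj₁ (arc , _)) (inj₂ (_ , _ , min)) = ⊥-elim (arc-not-min arc min)
  plus-arc-source-unique (inj₂ (_ , _ , min)) (inj₁ (arc′ , _)) = ⊥-elim (arc-not-min arc′ min)
  plus-arc-source-unique (inj₂ (refl , _)) (inj₂ (j≡1+i′ , _)) = suc-injective j≡1+i′

  plus-arc-target-unique : PlusArc Λ i j → PlusArc Λ i j′ → j ≡ j′
  plus-arc-target-unique (inj₁ (arc , _)) (inj₁ (arc′ , _)) = arc-target-unique arc arc′
  plus-arc-target-unique (inj₁ (arc , _)) (inj₂ (_ , max , _)) = ⊥-elim (arc-not-max arc max)
  plus-arc-target-unique (inj₂ (_ , max , _)) (inj₁ (arc′ , _)) = ⊥-elim (arc-not-max arc′ max)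
  plus-arc-target-unique (inj₂ (refl , _)) (inj₂ (refl , _)) = refl

  -- Whether j has an incoming plus-arc is decidable (its source is below j).
  incoming⁺? : ∀ j → Dec (∃ λ i → PlusArc Λ i j)
  incoming⁺? j = map′ (λ (i , _ , arc) → i , arc) (λ (i , arc) → i , plus-arc-< arc , arc)
                      (anyUpTo? (λ i → plus-arc? i j) j)

  module Plus = ArcSystem n (PlusArc Λ) incoming⁺? plus-arc-< plus-arc-in
                  plus-arc-source-unique plus-arc-target-unique

  inside-arc-in : IsArc Λ i j → i < m → m < j → In n m
  inside-arc-in (_ , s , _) i<m m<j =
    ≤-trans (proj₁ (proj₁ (same-block-in s))) (<⇒≤ i<m) , ≤-trans (<⇒≤ m<j) (proj₂ (proj₂ (same-block-in s)))

  -- With Λ noncrossing, an arc (i, j + 1) of Λ with i < j forces j to be a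
  -- block maximum: an arc leaving j would cross it.
  arc-over⇒max : NonCrossing Λ → IsArc Λ i (suc j) → i < j → IsBlockMax Λ j
  arc-over⇒max {i} {j} nc arc i<j with is-block-max? j
  ... | yes max = max
  ... | no not-max with arc-out (inside-arc-in arc i<j ≤-refl) not-max
  ...   | l , arc′ = ⊥-elim (nc i j (suc j) l arc arc′ (i<j , ≤-refl , 1+j<l))
    where
    1+j<l : suc j < l
    1+j<l = ≤∧≢⇒< (proj₁ arc′)
      λ 1+j≡l → <⇒≢ i<j (arc-source-unique arc (subst (IsArc Λ j) (sym 1+j≡l) arc′))

  incoming⁺⇔max : NonCrossing Λ → 1 ≤ j → suc j ≤ n → (∃ λ i → PlusArc Λ i (suc j)) ⇔ IsBlockMax Λ j
  incoming⁺⇔max {j} nc 1≤j 1+j≤n = mk⇔ max-of-incoming incoming-of-max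
    where
    max-of-incoming : (∃ λ i → PlusArc Λ i (suc j)) → IsBlockMax Λ j
    max-of-incoming (_ , inj₂ (refl , max , _)) = max
    max-of-incoming (i , inj₁ (arc , 1+j≢1+i)) =
      arc-over⇒max nc arc (≤∧≢⇒< (≤-pred (proj₁ arc)) λ i≡j → 1+j≢1+i (cong suc (sym i≡j)))
    incoming-of-max : IsBlockMax Λ j → ∃ λ i → PlusArc Λ i (suc j)
    incoming-of-max max with is-block-min? (suc j)
    ... | yes min = j , inj₂ (refl , max , min)
    ... | no not-min =
      let i , arc = arc-into (s≤s z≤n , 1+j≤n) not-min in
      i , inj₁ (arc , λ 1+j≡1+i → arc-not-max (subst (λ v → IsArc Λ v (suc j)) (sym (suc-injective 1+j≡1+i)) arc) max)

  no-incoming⁺-at-1 : Plus.Initial 1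
  no-incoming⁺-at-1 (_ , arc) = <⇒≱ (plus-arc-< arc) (proj₁ (proj₁ (plus-arc-in arc)))

  n-is-block-max : 1 ≤ n → IsBlockMax Λ n
  n-is-block-max 1≤n = same-block-refl (1≤n , ≤-refl) , λ m s → proj₂ (proj₂ (same-block-in s))

  plus-rank : NonCrossing Λ → 1 ≤ n → #blocks Plus.Λ′ ≡ n + 1 ∸ #blocks Λ
  plus-rank nc 1≤n = begin
    #blocks Plus.Λ′                                   ≡⟨ Plus.#blocks-Λ′ ⟩
    #initial                                          ≡⟨ m+n∸n≡m #initial #maxima ⟨
    #initial + #maxima ∸ #maxima                      ≡⟨ cong₂ _∸_ complementary (sym #blocks≡#maxima) ⟩
    suc n ∸ #blocks Λ                                 ≡⟨ cong (_∸ #blocks Λ) (+-comm 1 n) ⟩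
    n + 1 ∸ #blocks Λ                                 ∎
    where
    #initial #maxima : ℕ
    #initial = count Plus.initial? (range n)
    #maxima = count is-block-max? (range n)
    initial⇔not-max : ∀ j → 1 ≤ j → j < n → Plus.Initial (suc j) ⇔ (¬ IsBlockMax Λ j)
    initial⇔not-max j 1≤j j<n = mk⇔ (λ none max → none (from (incoming⁺⇔max nc 1≤j j<n) max))
                                    (λ not-max incoming → not-max (to (incoming⁺⇔max nc 1≤j j<n) incoming))
    complementary : #initial + #maxima ≡ suc n
    complementary = count-complementary Plus.initial? is-block-max? n 1≤n
                      no-incoming⁺-at-1 (n-is-block-max 1≤n) initial⇔not-max

proposition2p4 : (n : ℕ) → 1 ≤ n → (Λ : Blocks) → (k : ℕ) →
    IsPartition n Λ → NonCrossing Λ → #blocks Λ ≡ k →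
    Σ Blocks (λ Λ⁺ → IsPartition n Λ⁺ × IsPlusOf Λ⁺ Λ ×
      NonCrossing Λ⁺ × #blocks Λ⁺ ≡ n + 1 ∸ k)
proposition2p4 n 1≤n Λ k isPartition nc refl =
  Plus.Λ′ , Plus.partition , Plus.arcs , plus-noncrossing nc Plus.arcs , plus-rank nc 1≤n
  where open PartitionFacts isPartition
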